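{- Given a self-dual poset $P$, let $f \in \mathrm{Inc}^q(P)$ such that $\overline{f}$ is a linear extension. Moreover, given $r,\ell,\tau$ where $\ell$ is the period of $\mathrm{Con}(f)$, $\overline{f}$ is $r$-packed, and $\tau$ is the size of the promotion orbit of $\overline{f}$ in $\mathrm{Inc}^r(P)$, suppose $\gcd(r\ell/q,\tau) = 1$. If $\mathcal{O}$ is the promotion orbit of $\mathrm{Inc}^q(P)$ containing $f$, then the orbit $\mathcal{O}$ is orbitmesic with respect to the total sum statistic $\mathrm{Tot}$.
   Context: $P$ is a finite self-dual poset. $\mathrm{Inc}^q(P)$ is the set of increasing labelings $f:P\to[q]$ ($f(x)<f(y)$ whenever $x<y$). Promotion $\mathrm{Pro}$: replace labels $1$ by empty boxes; for $i=2,\dots,q$ slide boxes upward (a box at $x$ becomes $i$ if some $y\gtrdot x$ is labeled $i$, and that element becomes a box); replace boxes by $q+1$ and subtract $1$ from all labels. $\mathrm{Con}(f)=(c_1,\dots,c_q)$ with $c_i=1$ iff label $i$ is used; its period is the least $\ell$ such that $\ell$ cyclic shifts return the same word. The deflation $\overline{f}$ replaces the $j$-th smallest used label by $j$; it is $r$-packed if $f$ uses exactly $r$ labels. A linear extension is an increasing labeling that is a bijection onto $[|P|]$. $\mathrm{Tot}(f)=\sum_x f(x)$. Orbitmesic: orbit average equals the average over all of $\mathrm{Inc}^q(P)$. -}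

module Defs where

open import Level using (0ℓ)
open import Data.Nat using (ℕ; zero; suc; _+_; _*_; _∸_; _≤_; _<_; _≤?_; _<?_; _≡ᵇ_; NonZero)
open import Data.Nat.DivMod using (_%_)
open import Data.Nat.Properties using (_≟_)
open import Data.Fin using (Fin; zero; suc; toℕ)
import Data.Fin.Properties as FinP
open import Data.Bool using (Bool; true; false; _∧_; not; if_then_else_)
open import Data.Maybe using (Maybe; just; nothing; maybe)
open import Data.List using (List; []; _∷_; map; concatMap; filter; length; allFin; foldl; upTo; deduplicate)
open import Data.Bool.ListAction using (any)
open import Data.Nat.ListAction using (sum)
open import Data.Product using (Σ; _×_; _,_; ∃)
open import Function.Bundles using (_↔_; Inverse)
open import Relation.Binary using (Rel; Decidable; IsPartialOrder)
open import Relation.Binary.PropositionalEquality using (_≡_; _≢_)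
open import Relation.Nullary using (¬_; Dec; yes; no)
open import Relation.Nullary.Decidable using (⌊_⌋; _×-dec_; _→-dec_; ¬?)

record FinPoset (n : ℕ) : Set₁ where
  field
    _≼_            : Rel (Fin n) 0ℓ
    isPartialOrder : IsPartialOrder _≡_ _≼_
    _≼?_           : Decidable _≼_

  _≺_ : Rel (Fin n) 0ℓ
  x ≺ y = (x ≼ y) × (x ≢ y)

  _≺?_ : Decidable _≺_
  x ≺? y = (x ≼? y) ×-dec ¬? (x FinP.≟ y)

  ltᵇ : Fin n → Fin n → Bool
  ltᵇ x y = ⌊ x ≺? y ⌋

  covᵇ : Fin n → Fin n → Bool
  covᵇ x y = ltᵇ x y ∧ not (any (λ z → ltᵇ x z ∧ ltᵇ z y) (allFin n))

open FinPoset public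

SelfDual : ∀ {n} → FinPoset n → Set
SelfDual {n} P =
  Σ (Fin n ↔ Fin n) λ φ →
    ∀ x y → ((_≼_ P x y) → _≼_ P (Inverse.to φ y) (Inverse.to φ x))
          × ((_≼_ P (Inverse.to φ y) (Inverse.to φ x)) → _≼_ P x y)

Labeling : ℕ → Set
Labeling n = Fin n → ℕ

InInc : ∀ {n} → FinPoset n → ℕ → Labeling n → Set
InInc {n} P q f =
  (∀ x → (1 ≤ f x) × (f x ≤ q)) × (∀ x y → _≺_ P x y → f x < f y)

inInc? : ∀ {n} (P : FinPoset n) (q : ℕ) (f : Labeling n) → Dec (InInc P q f)
inInc? P q f =
  FinP.all? (λ x → (1 ≤? f x) ×-dec (f x ≤? q))
  ×-dec FinP.all? (λ x → FinP.all? (λ y → (_≺?_ P x y) →-dec (f x <? f y)))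

labels : ℕ → List ℕ
labels q = map suc (upTo q)

allFuns : (n q : ℕ) → List (Labeling n)
allFuns zero    q = (λ ()) ∷ []
allFuns (suc n) q =
  concatMap (λ v → map (λ g → λ { zero → v ; (suc i) → g i }) (allFuns n q)) (labels q)

IncList : ∀ {n} → FinPoset n → ℕ → List (Labeling n)
IncList {n} P q = filter (inInc? P q) (allFuns n q)

Tot : ∀ {n} → Labeling n → ℕ
Tot {n} f = sum (map f (allFin n))

-- Promotion (via K-jeu-de-taquin slides; nothing = empty box)

private
  isLabelᵇ : ℕ → Maybe ℕ → Bool
  isLabelᵇ i (just v) = v ≡ᵇ i
  isLabelᵇ i nothing  = false

  isBoxᵇ : Maybe ℕ → Bool
  isBoxᵇ (just _) = false
  isBoxᵇ nothing  = true

slide : ∀ {n} → FinPoset n → ℕ → (Fin n → Maybe ℕ) → (Fin n → Maybe ℕ)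
slide {n} P i s x with s x
... | nothing = if any (λ y → covᵇ P x y ∧ isLabelᵇ i (s y)) (allFin n)
                  then just i else nothing
... | just v  = if (v ≡ᵇ i) ∧ any (λ z → covᵇ P z x ∧ isBoxᵇ (s z)) (allFin n)
                  then nothing else just v

Pro : ∀ {n} → FinPoset n → ℕ → Labeling n → Labeling n
Pro {n} P q f x = maybe (λ v → v ∸ 1) q (slides x)
  where
    start : Fin n → Maybe ℕ
    start y = if f y ≡ᵇ 1 then nothing else just (f y)
    slides : Fin n → Maybe ℕ
    slides = foldl (λ s i → slide P i s) start (map (λ k → 2 + k) (upTo (q ∸ 1)))
    -- finally: boxes ↦ q+1, then subtract 1 everywhere

iter : ∀ {A : Set} → (A → A) → ℕ → A → A
iter g zero    a = a
iter g (suc k) a = g (iter g k a)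

IsOrbitSize : ∀ {n} → FinPoset n → ℕ → Labeling n → ℕ → Set
IsOrbitSize P q f m =
  (0 < m) × (∀ x → iter (Pro P q) m f x ≡ f x)
  × (∀ k → 0 < k → k < m → ¬ (∀ x → iter (Pro P q) k f x ≡ f x))

-- orbitmesic: orbit average of Tot = global average of Tot over Inc^q(P)
-- (cross-multiplied: Σ_{O} Tot · |Inc^q(P)| = Σ_{Inc^q(P)} Tot · |O|)
Orbitmesic : ∀ {n} → FinPoset n → ℕ → Labeling n → ℕ → Set
Orbitmesic P q f m =
  sum (map (λ k → Tot (iter (Pro P q) k f)) (upTo m)) * length (IncList P q)
  ≡ sum (map Tot (IncList P q)) * m

used : ∀ {n} → Labeling n → ℕ → Bool
used {n} f j = any (λ x → f x ≡ᵇ j) (allFin n)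

-- Con(f) = (c_1,…,c_q), indexed by i ∈ {0,…,q-1} ↦ c_{i+1}
Con : ∀ {n} → Labeling n → (q : ℕ) → Fin q → Bool
Con f q i = used f (suc (toℕ i))

ShiftInvariant : (q : ℕ) → .{{NonZero q}} → (Fin q → Bool) → ℕ → Set
ShiftInvariant q w ℓ =
  ∀ (i : Fin q) → w (Data.Fin.fromℕ< (Data.Nat.DivMod.m%n<n (toℕ i + ℓ) q)) ≡ w i

IsPeriod : (q : ℕ) → .{{NonZero q}} → (Fin q → Bool) → ℕ → Set
IsPeriod q w ℓ =
  (0 < ℓ) × ShiftInvariant q w ℓ × (∀ k → 0 < k → k < ℓ → ¬ ShiftInvariant q w k)

usedLabels : ∀ {n} → Labeling n → List ℕ
usedLabels {n} f = deduplicate _≟_ (map f (allFin n))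

deflate : ∀ {n} → Labeling n → Labeling n
deflate f x = length (filter (_≤? f x) (usedLabels f))

Packed : ∀ {n} → ℕ → Labeling n → Set
Packed r g = length (usedLabels g) ≡ r

IsLinearExtension : ∀ {n} → FinPoset n → Labeling n → Set
IsLinearExtension {n} P g =
  InInc P n g
  × (∀ x y → g x ≡ g y → x ≡ y)
  × (∀ k → 1 ≤ k → k ≤ n → ∃ λ x → g x ≡ k)

{-# OPTIONS --safe #-}
-- Since the deflation of f is a linear extension, f is injective. For an injective labeling each
-- slide of promotion either does nothing or swaps the unique box with the unique element carrying
-- the label being slid, so Pro f = ρ ∘ f ∘ π for a permutation π of P, where ρ relabels cyclically
-- (1 ↦ q, v ↦ v − 1). Hence in q·m steps of an orbit of size m every element runs m times through
-- all labels 1, …, q, and the orbit average of Tot is n(q + 1)/2. The self-duality φ of P gives the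
-- involution f ↦ (q + 1) − f ∘ φ of Inc^q(P), which pairs labelings with total n(q + 1), so the
-- global average is n(q + 1)/2 as well.
module Submission where

open import Defs
open import Data.Nat using (ℕ; _*_; NonZero)
open import Data.Nat.DivMod using (_/_)
open import Data.Nat.GCD using (gcd)
open import Relation.Binary.PropositionalEquality using (_≡_)

open import Data.Bool using (Bool; true; false; T; _∧_; _∨_; not; if_then_else_)
open import Data.Bool.ListAction using (any; or)
open import Data.Bool.Properties using (T-∧; T?)
open import Data.Fin using (Fin; zero; suc; toℕ)
import Data.Fin.Properties as FinP
open import Data.Fin.Permutation as Perm using (Permutation′; _⟨$⟩ʳ_; _⟨$⟩ˡ_; _∘ₚ_; transpose)
import Data.Fin.Permutation.Components as PC
open import Data.List using (List; []; _∷_; _++_; map; filter; concatMap; length; lookup; tabulate; allFin; applyUpTo; upTo; foldl)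
open import Data.List.Properties using (map-cong; map-cong-local; map-∘; map-++)
open import Data.List.Membership.Propositional using (_∈_; lose)
open import Data.List.Membership.Propositional.Properties using (∈-lookup; ∈-allFin; ∈-map⁺; ∈-upTo⁺)
open import Data.List.Relation.Unary.All as All using (All; []; _∷_)
open import Data.List.Relation.Unary.All.Properties using (all-filter)
open import Data.List.Relation.Unary.AllPairs using (_∷_)
open import Data.List.Relation.Unary.Any using (here; there; satisfied)
open import Data.List.Relation.Unary.Any.Properties using (any⁺; any⁻)
open import Data.List.Relation.Unary.Unique.Propositional using (Unique)
import Data.List.Relation.Unary.Unique.Propositional.Properties as Unique
open import Data.Maybe using (Maybe; just; nothing; maybe; is-just; is-nothing; fromMaybe)
open import Data.Maybe.Properties using (≡-dec)
open import Data.Nat using (zero; suc; _+_; _∸_; _≤_; _<_; _≟_; _≤?_; _≡ᵇ_; z≤n; s≤s)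
open import Data.Nat.ListAction using (sum)
open import Data.Nat.ListAction.Properties using (sum-++)
open import Data.Nat.Properties
open import Data.Nat.Tactic.RingSolver using (solve-∀)
open import Data.Product using (Σ; _×_; _,_; proj₁; proj₂)
open import Function using (_∘_; flip; _⇔_; mk⇔; Equivalence; Injective; Injection)
open import Function.Properties.Inverse using (↔⇒↣)
open import Level using (0ℓ)
open import Relation.Binary using (DecidableEquality)
open import Relation.Binary.PropositionalEquality
  using (_≢_; _≗_; refl; sym; trans; subst; subst₂; cong; cong₂; module ≡-Reasoning)
open import Relation.Nullary using (¬_; Dec; yes; no; contradiction)
open import Relation.Nullary.Decidable using (dec-true; dec-false; _×-dec_)
open import Relation.Unary using (Pred; Decidable)

open import Algebra.Properties.CommutativeSemigroup +-commutativeSemigroup using ()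
  renaming (interchange to [m+n]+[o+p]≡[m+o]+[n+p])
open import Algebra.Properties.CommutativeSemigroup *-commutativeSemigroup using ()
  renaming (x∙yz≈y∙xz to m*[n*o]≡n*[m*o])
open import Algebra.Properties.Semiring.Sum +-*-semiring
  using (sum-syntax; sum-cong-≗; ∑-comm; ∑-permute; ∑-distrib-+; *-distribˡ-sum; *-distribʳ-sum)

private
  variable
    A B : Set
    m n : ℕ

𝟙 : {P : Set} → Dec P → ℕ
𝟙 (yes _) = 1
𝟙 (no _)  = 0

𝟙-cong : {P Q : Set} → P ⇔ Q → (p : Dec P) (q : Dec Q) → 𝟙 p ≡ 𝟙 q
𝟙-cong P⇔Q (yes _) (yes _) = refl
𝟙-cong P⇔Q (yes p) (no ¬q) = contradiction (Equivalence.to P⇔Q p) ¬q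
𝟙-cong P⇔Q (no ¬p) (yes q) = contradiction (Equivalence.from P⇔Q q) ¬p
𝟙-cong P⇔Q (no _)  (no _)  = refl

count : {P : Pred A 0ℓ} → Decidable P → List A → ℕ
count P? xs = sum (map (𝟙 ∘ P?) xs)

count-cong : {P Q : Pred A 0ℓ} (P? : Decidable P) (Q? : Decidable Q) {xs : List A} →
             All (λ x → P x ⇔ Q x) xs → count P? xs ≡ count Q? xs
count-cong P? Q? eqs = cong sum (map-cong-local (All.map (λ {x} e → 𝟙-cong e (P? x) (Q? x)) eqs))

count-none : {P : Pred A 0ℓ} (P? : Decidable P) {xs : List A} → All (¬_ ∘ P) xs → count P? xs ≡ 0
count-none P? []                = refl
count-none P? {x ∷ _} (¬px ∷ ¬ps) with P? x
... | yes px = contradiction px ¬px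
... | no _   = count-none P? ¬ps

count-unique : (_≟ᴬ_ : DecidableEquality A) {x : A} {xs : List A} →
               Unique xs → x ∈ xs → count (_≟ᴬ x) xs ≡ 1
count-unique _≟ᴬ_ {x} (x≢xs ∷ _) (here refl) with x ≟ᴬ x
... | yes _  = cong suc (count-none (_≟ᴬ x) (All.map (λ x≢y y≡x → x≢y (sym y≡x)) x≢xs))
... | no x≢x = contradiction refl x≢x
count-unique _≟ᴬ_ {x} {y ∷ _} (y≢ys ∷ u) (there x∈ys) with y ≟ᴬ x
... | yes refl = contradiction refl (All.lookup y≢ys x∈ys)
... | no _     = count-unique _≟ᴬ_ u x∈ys

count-filter : {P Q : Pred A 0ℓ} (P? : Decidable P) (Q? : Decidable Q) →
               (∀ {x} → P x → Q x) → (xs : List A) → count P? (filter Q? xs) ≡ count P? xs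
count-filter P? Q? P⇒Q []       = refl
count-filter P? Q? P⇒Q (x ∷ xs) with Q? x
... | yes _  = cong (𝟙 (P? x) +_) (count-filter P? Q? P⇒Q xs)
... | no ¬qx with P? x
...   | yes px = contradiction (P⇒Q px) ¬qx
...   | no _   = count-filter P? Q? P⇒Q xs

count-map : {P : Pred B 0ℓ} (P? : Decidable P) (f : A → B) (xs : List A) →
            count P? (map f xs) ≡ count (P? ∘ f) xs
count-map P? f xs = cong sum (sym (map-∘ xs))

count-concatMap : {P : Pred B 0ℓ} (P? : Decidable P) (F : A → List B) (xs : List A) →
                  count P? (concatMap F xs) ≡ sum (map (count P? ∘ F) xs)
count-concatMap P? F []       = refl
count-concatMap P? F (x ∷ xs) = begin
  sum (map (𝟙 ∘ P?) (F x ++ concatMap F xs))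
    ≡⟨ cong sum (map-++ (𝟙 ∘ P?) (F x) (concatMap F xs)) ⟩
  sum (map (𝟙 ∘ P?) (F x) ++ map (𝟙 ∘ P?) (concatMap F xs))
    ≡⟨ sum-++ (map (𝟙 ∘ P?) (F x)) _ ⟩
  count P? (F x) + count P? (concatMap F xs)
    ≡⟨ cong (count P? (F x) +_) (count-concatMap P? F xs) ⟩
  count P? (F x) + sum (map (count P? ∘ F) xs) ∎
  where open ≡-Reasoning

sum-map-*ʳ : (f : A → ℕ) (c : ℕ) (xs : List A) → sum (map (λ x → f x * c) xs) ≡ sum (map f xs) * c
sum-map-*ʳ f c []       = refl
sum-map-*ʳ f c (x ∷ xs) =
  trans (cong (f x * c +_) (sum-map-*ʳ f c xs)) (sym (*-distribʳ-+ c (f x) (sum (map f xs))))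

sum-map-+-const : (f g : A → ℕ) {c : ℕ} {xs : List A} → All (λ x → f x + g x ≡ c) xs →
                  sum (map f xs) + sum (map g xs) ≡ length xs * c
sum-map-+-const f g []                            = refl
sum-map-+-const f g {c} {x ∷ xs} (fx+gx≡c ∷ rest) = begin
  (f x + sum (map f xs)) + (g x + sum (map g xs))  ≡⟨ [m+n]+[o+p]≡[m+o]+[n+p] (f x) _ (g x) _ ⟩
  (f x + g x) + (sum (map f xs) + sum (map g xs))  ≡⟨ cong₂ _+_ fx+gx≡c (sum-map-+-const f g rest) ⟩
  c + length xs * c                                ∎
  where open ≡-Reasoning

sum-map≡∑-lookup : (h : A → ℕ) (xs : List A) → sum (map h xs) ≡ ∑[ i < length xs ] h (lookup xs i)
sum-map≡∑-lookup h []       = refl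
sum-map≡∑-lookup h (x ∷ xs) = cong (h x +_) (sum-map≡∑-lookup h xs)

sum-map-tabulate : (h : A → ℕ) (f : Fin n → A) → sum (map h (tabulate f)) ≡ ∑[ i < n ] h (f i)
sum-map-tabulate {n = zero}  h f = refl
sum-map-tabulate {n = suc n} h f = cong (h (f zero) +_) (sum-map-tabulate h (f ∘ suc))

∑-double-count : (R : Fin m → Fin n → Set) (R? : ∀ i j → Dec (R i j)) {u : Fin m → ℕ} {v : Fin n → ℕ} →
                 (∀ {i j} → R i j → u i ≡ v j) →
                 (∀ i → ∑[ j < n ] 𝟙 (R? i j) ≡ 1) → (∀ j → ∑[ i < m ] 𝟙 (R? i j) ≡ 1) →
                 ∑[ i < m ] u i ≡ ∑[ j < n ] v j
∑-double-count {m} {n} R R? {u} {v} R⇒≡ rows cols = begin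
  ∑[ i < m ] u i                           ≡⟨ sum-cong-≗ (λ i → sym (weigh (R? i) (rows i))) ⟩
  ∑[ i < m ] ∑[ j < n ] (𝟙 (R? i j) * u i) ≡⟨ sum-cong-≗ (λ i → sum-cong-≗ (λ j → transfer (R? i j))) ⟩
  ∑[ i < m ] ∑[ j < n ] (𝟙 (R? i j) * v j) ≡⟨ ∑-comm (λ i j → 𝟙 (R? i j) * v j) ⟩
  ∑[ j < n ] ∑[ i < m ] (𝟙 (R? i j) * v j) ≡⟨ sum-cong-≗ (λ j → weigh (λ i → R? i j) (cols j)) ⟩
  ∑[ j < n ] v j                           ∎
  where
  open ≡-Reasoning
  weigh : ∀ {k} {S : Fin k → Set} (S? : ∀ i → Dec (S i)) {w} →
          ∑[ i < k ] 𝟙 (S? i) ≡ 1 → ∑[ i < k ] (𝟙 (S? i) * w) ≡ w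
  weigh S? {w} one = trans (sym (*-distribʳ-sum w (𝟙 ∘ S?))) (trans (cong (_* w) one) (*-identityˡ w))
  transfer : ∀ {i j} (r? : Dec (R i j)) → 𝟙 r? * u i ≡ 𝟙 r? * v j
  transfer (yes r) = cong (1 *_) (R⇒≡ r)
  transfer (no _)  = refl

sum-map-double-count : (R : A → B → Set) (R? : ∀ a b → Dec (R a b)) {u : A → ℕ} {v : B → ℕ}
                       (xs : List A) (ys : List B) → (∀ {a b} → R a b → u a ≡ v b) →
                       All (λ a → count (R? a) ys ≡ 1) xs → All (λ b → count (λ a → R? a b) xs ≡ 1) ys →
                       sum (map u xs) ≡ sum (map v ys)
sum-map-double-count R R? {u} {v} xs ys R⇒≡ rows cols = begin
  sum (map u xs)                           ≡⟨ sum-map≡∑-lookup u xs ⟩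
  ∑[ i < length xs ] u (lookup xs i)       ≡⟨ ∑-double-count _ (λ i j → R? (lookup xs i) (lookup ys j)) R⇒≡ row col ⟩
  ∑[ j < length ys ] v (lookup ys j)       ≡⟨ sum-map≡∑-lookup v ys ⟨
  sum (map v ys)                           ∎
  where
  open ≡-Reasoning
  row : ∀ i → ∑[ j < length ys ] 𝟙 (R? (lookup xs i) (lookup ys j)) ≡ 1
  row i = trans (sym (sum-map≡∑-lookup _ ys)) (All.lookup rows (∈-lookup i))
  col : ∀ j → ∑[ i < length xs ] 𝟙 (R? (lookup xs i) (lookup ys j)) ≡ 1
  col j = trans (sym (sum-map≡∑-lookup _ xs)) (All.lookup cols (∈-lookup j))

∑ℕ : ℕ → (ℕ → ℕ) → ℕ
∑ℕ zero    a = 0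
∑ℕ (suc N) a = a 0 + ∑ℕ N (a ∘ suc)

∑ℕ≡∑ : ∀ N (a : ℕ → ℕ) → ∑ℕ N a ≡ ∑[ k < N ] a (toℕ k)
∑ℕ≡∑ zero    a = refl
∑ℕ≡∑ (suc N) a = cong (a 0 +_) (∑ℕ≡∑ N (a ∘ suc))

sum-map-applyUpTo : (h f : ℕ → ℕ) (N : ℕ) → sum (map h (applyUpTo f N)) ≡ ∑ℕ N (h ∘ f)
sum-map-applyUpTo h f zero    = refl
sum-map-applyUpTo h f (suc N) = cong (h (f 0) +_) (sum-map-applyUpTo h (f ∘ suc) N)

∑ℕ-cong< : ∀ N {a b : ℕ → ℕ} → (∀ {k} → k < N → a k ≡ b k) → ∑ℕ N a ≡ ∑ℕ N b
∑ℕ-cong< zero    eq = refl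
∑ℕ-cong< (suc N) eq = cong₂ _+_ (eq (s≤s z≤n)) (∑ℕ-cong< N (eq ∘ s≤s))

∑ℕ-cong : ∀ N {a b : ℕ → ℕ} → (∀ k → a k ≡ b k) → ∑ℕ N a ≡ ∑ℕ N b
∑ℕ-cong N eq = ∑ℕ-cong< N (λ {k} _ → eq k)

∑ℕ-+ : ∀ M N (a : ℕ → ℕ) → ∑ℕ (M + N) a ≡ ∑ℕ M a + ∑ℕ N (λ k → a (M + k))
∑ℕ-+ zero    N a = refl
∑ℕ-+ (suc M) N a = trans (cong (a 0 +_) (∑ℕ-+ M N (a ∘ suc))) (sym (+-assoc (a 0) _ _))

Periodic : ℕ → (ℕ → ℕ) → Set
Periodic p a = ∀ k → a (p + k) ≡ a k

∑ℕ-periodic-* : ∀ {p a} → Periodic p a → ∀ j → ∑ℕ (j * p) a ≡ j * ∑ℕ p a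
∑ℕ-periodic-* {p} {a} per zero    = refl
∑ℕ-periodic-* {p} {a} per (suc j) = begin
  ∑ℕ (p + j * p) a                       ≡⟨ ∑ℕ-+ p (j * p) a ⟩
  ∑ℕ p a + ∑ℕ (j * p) (λ k → a (p + k)) ≡⟨ cong (∑ℕ p a +_) (∑ℕ-cong (j * p) per) ⟩
  ∑ℕ p a + ∑ℕ (j * p) a                  ≡⟨ cong (∑ℕ p a +_) (∑ℕ-periodic-* per j) ⟩
  ∑ℕ p a + j * ∑ℕ p a                    ∎
  where open ≡-Reasoning

∑ℕ-periodic-suc : ∀ {p a} → Periodic p a → ∑ℕ p (a ∘ suc) ≡ ∑ℕ p a
∑ℕ-periodic-suc {p} {a} per = +-cancelˡ-≡ (a 0) _ _ (begin
  ∑ℕ (suc p) a                        ≡⟨ cong (λ N → ∑ℕ N a) (+-comm 1 p) ⟩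
  ∑ℕ (p + 1) a                        ≡⟨ ∑ℕ-+ p 1 a ⟩
  ∑ℕ p a + (a (p + 0) + 0)            ≡⟨ cong (λ x → ∑ℕ p a + (x + 0)) (per 0) ⟩
  ∑ℕ p a + (a 0 + 0)                  ≡⟨ cong (∑ℕ p a +_) (+-identityʳ (a 0)) ⟩
  ∑ℕ p a + a 0                        ≡⟨ +-comm (∑ℕ p a) (a 0) ⟩
  a 0 + ∑ℕ p a                        ∎)
  where open ≡-Reasoning

∑ℕ-periodic-shift : ∀ {p a} → Periodic p a → ∀ j → ∑ℕ p (λ k → a (j + k)) ≡ ∑ℕ p a
∑ℕ-periodic-shift per zero    = refl
∑ℕ-periodic-shift {p} {a} per (suc j) =
  trans (∑ℕ-periodic-shift per-suc j) (∑ℕ-periodic-suc per)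
  where
  per-suc : Periodic p (a ∘ suc)
  per-suc k = trans (cong a (sym (+-suc p k))) (per (suc k))

∑ℕ-countdown : ∀ N → 2 * ∑ℕ N (N ∸_) ≡ N * suc N
∑ℕ-countdown zero    = refl
∑ℕ-countdown (suc N) = begin
  2 * (suc N + ∑ℕ N (N ∸_))      ≡⟨ *-distribˡ-+ 2 (suc N) _ ⟩
  2 * suc N + 2 * ∑ℕ N (N ∸_)    ≡⟨ cong (2 * suc N +_) (∑ℕ-countdown N) ⟩
  2 * suc N + N * suc N          ≡⟨ step N ⟩
  suc N * suc (suc N)            ∎
  where
  open ≡-Reasoning
  step : ∀ N → 2 * suc N + N * suc N ≡ suc N * suc (suc N)
  step = solve-∀

iter-+ : (g : A → A) (k m : ℕ) (x : A) → iter g (k + m) x ≡ iter g k (iter g m x)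
iter-+ g zero    m x = refl
iter-+ g (suc k) m x = cong g (iter-+ g k m x)

iter-preserves : {Q : Pred A 0ℓ} {g : A → A} → (∀ {x} → Q x → Q (g x)) → ∀ k {x} → Q x → Q (iter g k x)
iter-preserves g-Q zero    qx = qx
iter-preserves {Q = Q} {g} g-Q (suc k) qx = g-Q (iter-preserves {Q = Q} {g} g-Q k qx)

iter-injective-on : {Q : Pred A 0ℓ} {g : A → A} → (∀ {x} → Q x → Q (g x)) →
                    (∀ {x y} → Q x → Q y → g x ≡ g y → x ≡ y) →
                    ∀ k {x y} → Q x → Q y → iter g k x ≡ iter g k y → x ≡ y
iter-injective-on g-Q g-inj zero    qx qy eq = eq
iter-injective-on {Q = Q} {g} g-Q g-inj (suc k) qx qy eq =
  iter-injective-on {Q = Q} {g} g-Q g-inj k qx qy (g-inj (preserves qx) (preserves qy) eq)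
  where
  preserves : ∀ {x} → Q x → Q (iter g k x)
  preserves = iter-preserves {Q = Q} {g} g-Q k

-- The cyclic relabeling

IsLabel : ℕ → ℕ → Set
IsLabel q v = (1 ≤ v) × (v ≤ q)

rotate : ℕ → ℕ → ℕ
rotate q 0             = 0
rotate q 1             = q
rotate q (suc (suc v)) = suc v

module _ {q : ℕ} where

  rotate-IsLabel : ∀ {v} → IsLabel q v → IsLabel q (rotate q v)
  rotate-IsLabel {1}           (_ , 1≤q)  = 1≤q , ≤-refl
  rotate-IsLabel {suc (suc v)} (_ , v<q) = s≤s z≤n , <⇒≤ v<q

  rotate-injective : ∀ {u v} → IsLabel q u → IsLabel q v → rotate q u ≡ rotate q v → u ≡ v
  rotate-injective {1}           {1}           _         _         _  = refl
  rotate-injective {1}           {suc (suc v)} _         (_ , v<q) eq = contradiction (subst (_< q) (sym eq) v<q) (<-irrefl refl)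
  rotate-injective {suc (suc u)} {1}           (_ , u<q) _         eq = contradiction (subst (_< q) eq u<q) (<-irrefl refl)
  rotate-injective {suc (suc u)} {suc (suc v)} _         _         eq = cong suc eq

  iter-rotate-IsLabel : ∀ k {v} → IsLabel q v → IsLabel q (iter (rotate q) k v)
  iter-rotate-IsLabel = iter-preserves {Q = IsLabel q} rotate-IsLabel

  iter-rotate-injective : ∀ k {u v} → IsLabel q u → IsLabel q v → iter (rotate q) k u ≡ iter (rotate q) k v → u ≡ v
  iter-rotate-injective = iter-injective-on {Q = IsLabel q} rotate-IsLabel rotate-injective

  iter-rotate-descends : ∀ j w → iter (rotate q) j (j + suc w) ≡ suc w
  iter-rotate-descends zero    w = refl
  iter-rotate-descends (suc j) w =
    cong (rotate q) (trans (cong (iter (rotate q) j) (sym (+-suc j (suc w)))) (iter-rotate-descends j (suc w)))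

  iter-rotate-from-top : ∀ {k} → k < q → iter (rotate q) k q ≡ q ∸ k
  iter-rotate-from-top {k} k<q = begin
    iter (rotate q) k q                       ≡⟨ cong (iter (rotate q) k) q≡k+1+w ⟨
    iter (rotate q) k (k + suc (q ∸ suc k))   ≡⟨ iter-rotate-descends k (q ∸ suc k) ⟩
    suc (q ∸ suc k)                           ≡⟨ m+n∸m≡n k (suc (q ∸ suc k)) ⟨
    k + suc (q ∸ suc k) ∸ k                   ≡⟨ cong (_∸ k) q≡k+1+w ⟩
    q ∸ k                                     ∎
    where
    open ≡-Reasoning
    q≡k+1+w : k + suc (q ∸ suc k) ≡ q
    q≡k+1+w = trans (+-suc k (q ∸ suc k)) (m+[n∸m]≡n k<q)

  iter-rotate-to : ∀ {v} → IsLabel q v → iter (rotate q) (q ∸ v) q ≡ v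
  iter-rotate-to {suc u} (_ , v≤q) =
    trans (cong (iter (rotate q) (q ∸ suc u)) (sym (m∸n+n≡m v≤q))) (iter-rotate-descends (q ∸ suc u) u)

  iter-rotate-period : ∀ {v} → IsLabel q v → iter (rotate q) q v ≡ v
  iter-rotate-period {suc u} (_ , v≤q) = begin
    iter (rotate q) q (suc u)                                ≡⟨ cong (λ k → iter (rotate q) k (suc u)) (m∸n+n≡m v≤q) ⟨
    iter (rotate q) ((q ∸ suc u) + suc u) (suc u)            ≡⟨ iter-+ (rotate q) (q ∸ suc u) (suc u) (suc u) ⟩
    iter (rotate q) (q ∸ suc u) (iter (rotate q) (suc u) (suc u))
                                                             ≡⟨ cong (iter (rotate q) (q ∸ suc u) ∘ rotate q) down-to-1 ⟩
    iter (rotate q) (q ∸ suc u) q                            ≡⟨ iter-rotate-to (s≤s z≤n , v≤q) ⟩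
    suc u                                                    ∎
    where
    open ≡-Reasoning
    down-to-1 : iter (rotate q) u (suc u) ≡ 1
    down-to-1 = subst (λ w → iter (rotate q) u w ≡ 1) (+-comm u 1) (iter-rotate-descends u 0)

  iter-rotate-periodic : ∀ {v} → IsLabel q v → Periodic q (λ k → iter (rotate q) k v)
  iter-rotate-periodic v-label k =
    trans (iter-+ (rotate q) q k _) (iter-rotate-period (iter-rotate-IsLabel k v-label))

  ∑ℕ-iter-rotate : ∀ {v} → IsLabel q v → ∑ℕ q (λ k → iter (rotate q) k v) ≡ ∑ℕ q (q ∸_)
  ∑ℕ-iter-rotate {v} v-label@(1≤v , v≤q) = begin
    ∑ℕ q (λ k → iter (rotate q) k v)                    ≡⟨ ∑ℕ-cong q (λ k → cong (iter (rotate q) k) (iter-rotate-to v-label)) ⟨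
    ∑ℕ q (λ k → iter (rotate q) k (iter (rotate q) j q)) ≡⟨ ∑ℕ-cong q (λ k → sym (iter-+ (rotate q) k j q)) ⟩
    ∑ℕ q (λ k → iter (rotate q) (k + j) q)               ≡⟨ ∑ℕ-cong q (λ k → cong (λ i → iter (rotate q) i q) (+-comm k j)) ⟩
    ∑ℕ q (λ k → iter (rotate q) (j + k) q)               ≡⟨ ∑ℕ-periodic-shift {q} (iter-rotate-periodic (≤-trans 1≤v v≤q , ≤-refl)) j ⟩
    ∑ℕ q (λ k → iter (rotate q) k q)                     ≡⟨ ∑ℕ-cong< q iter-rotate-from-top ⟩
    ∑ℕ q (q ∸_)                                          ∎
    where
    open ≡-Reasoning
    j = q ∸ v

  ∑ℕ-iter-rotate-* : ∀ {v} → IsLabel q v → ∀ m → 2 * ∑ℕ (m * q) (λ k → iter (rotate q) k v) ≡ m * (q * suc q)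
  ∑ℕ-iter-rotate-* {v} v-label m = begin
    2 * ∑ℕ (m * q) (λ k → iter (rotate q) k v)  ≡⟨ cong (2 *_) (∑ℕ-periodic-* (iter-rotate-periodic v-label) m) ⟩
    2 * (m * ∑ℕ q (λ k → iter (rotate q) k v))  ≡⟨ m*[n*o]≡n*[m*o] 2 m _ ⟩
    m * (2 * ∑ℕ q (λ k → iter (rotate q) k v))  ≡⟨ cong (λ s → m * (2 * s)) (∑ℕ-iter-rotate v-label) ⟩
    m * (2 * ∑ℕ q (q ∸_))                        ≡⟨ cong (m *_) (∑ℕ-countdown q) ⟩
    m * (q * suc q)                              ∎
    where open ≡-Reasoning

-- Slides on injective states

transpose-matchˡ : ∀ (i j : Fin n) → PC.transpose i j i ≡ j
transpose-matchˡ i j rewrite dec-true (i FinP.≟ i) refl = refl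

transpose-matchʳ : ∀ (i j : Fin n) → PC.transpose i j j ≡ i
transpose-matchʳ i j with j FinP.≟ i
... | yes j≡i = j≡i
... | no _ rewrite dec-true (j FinP.≟ j) refl = refl

transpose-other : ∀ {i j k : Fin n} → k ≢ i → k ≢ j → PC.transpose i j k ≡ k
transpose-other {i = i} {j} {k} k≢i k≢j rewrite dec-false (k FinP.≟ i) k≢i | dec-false (k FinP.≟ j) k≢j = refl

permute-injective : (π : Permutation′ n) → Injective _≡_ _≡_ (π ⟨$⟩ʳ_)
permute-injective π = Injection.injective (↔⇒↣ π)

injective-resp-≗ : {f g : Fin n → A} → f ≗ g → Injective _≡_ _≡_ g → Injective _≡_ _≡_ f
injective-resp-≗ f≗g g-inj eq = g-inj (trans (sym (f≗g _)) (trans eq (f≗g _)))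

if-T : ∀ {b} {x y : A} → T b → (if b then x else y) ≡ x
if-T {b = true} _ = refl

if-¬T : ∀ {b} {x y : A} → ¬ T b → (if b then x else y) ≡ y
if-¬T {b = true}  ¬t = contradiction _ ¬t
if-¬T {b = false} _  = refl

any-allFin⁺ : {p : Fin n → Bool} (y : Fin n) → T (p y) → T (any p (allFin n))
any-allFin⁺ {p = p} y py = any⁺ p (lose (∈-allFin y) py)

any-allFin⁻ : {p : Fin n → Bool} → (∀ y → ¬ T (p y)) → ¬ T (any p (allFin n))
any-allFin⁻ {n} {p = p} none t = let (y , py) = satisfied (any⁻ p (allFin n) t) in none y py

holdsLabel : ℕ → Maybe ℕ → Bool
holdsLabel i = maybe (_≡ᵇ i) false

fills : FinPoset n → ℕ → (Fin n → Maybe ℕ) → Fin n → Bool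
fills {n} P i s x = any (λ y → covᵇ P x y ∧ holdsLabel i (s y)) (allFin n)

vacates : FinPoset n → (Fin n → Maybe ℕ) → Fin n → Bool
vacates {n} P s x = any (λ z → covᵇ P z x ∧ is-nothing (s z)) (allFin n)

slideAt : ℕ → Bool → Bool → Maybe ℕ → Maybe ℕ
slideAt i filled vacated nothing  = if filled then just i else nothing
slideAt i filled vacated (just v) = if (v ≡ᵇ i) ∧ vacated then nothing else just v

-- `slide` tests cells with functions that Defs keeps private. On the chain 0 ⋖ 1 a slide
-- reduces to `if t ∨ false …` for a single such test t, which identifies t with
-- `holdsLabel` resp. `is-nothing`.
private
  chain₂ : FinPoset 2
  chain₂ = record { _≼_ = Data.Fin._≤_ ; isPartialOrder = FinP.≤-isPartialOrder ; _≼?_ = FinP._≤?_ }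

  label-probe : ∀ {i : ℕ} {b : Bool} → b ≡ is-just (if b ∨ false then just i else nothing)
  label-probe {b = true}  = refl
  label-probe {b = false} = refl

  holdsLabel-probe : ∀ i m → is-just (slide chain₂ i (λ { zero → nothing ; (suc _) → m }) zero) ≡ holdsLabel i m
  holdsLabel-probe i nothing  = refl
  holdsLabel-probe i (just v) with v ≡ᵇ i
  ... | true  = refl
  ... | false = refl

  box-probe : ∀ {b : Bool} → b ≡ not (is-just (if b ∨ false then nothing else just 0))
  box-probe {true}  = refl
  box-probe {false} = refl

  is-nothing-probe : ∀ m → not (is-just (slide chain₂ 0 (λ { zero → m ; (suc _) → just 0 }) (suc zero))) ≡ is-nothing m
  is-nothing-probe nothing  = refl
  is-nothing-probe (just _) = refl

any-cong : ∀ {p p′ : A → Bool} → p ≗ p′ → ∀ xs → any p xs ≡ any p′ xs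
any-cong p≗p′ xs = cong or (map-cong p≗p′ xs)

slide-unfold : ∀ (P : FinPoset n) i s x → slide P i s x ≡ slideAt i (fills P i s x) (vacates P s x) (s x)
slide-unfold {n} P i s x with s x
... | nothing = cong (if_then just i else nothing)
      (any-cong (λ y → cong (covᵇ P x y ∧_) (trans label-probe (holdsLabel-probe i (s y)))) (allFin n))
... | just v  = cong (λ b → if (v ≡ᵇ i) ∧ b then nothing else just v)
      (any-cong (λ z → cong (covᵇ P z x ∧_) (trans box-probe (is-nothing-probe (s z)))) (allFin n))

holdsLabel⁺ : ∀ {i m} → m ≡ just i → T (holdsLabel i m)
holdsLabel⁺ {i} refl = ≡⇒≡ᵇ i i refl

holdsLabel⁻ : ∀ {i m} → T (holdsLabel i m) → m ≡ just i
holdsLabel⁻ {i} {just v} t = cong just (≡ᵇ⇒≡ v i t)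

is-nothing⁺ : ∀ {m : Maybe A} → m ≡ nothing → T (is-nothing m)
is-nothing⁺ refl = _

is-nothing⁻ : ∀ {m : Maybe A} → T (is-nothing m) → m ≡ nothing
is-nothing⁻ {m = nothing} _ = refl

_⋖⟨_⟩_ : Fin n → FinPoset n → Fin n → Set
x ⋖⟨ P ⟩ y = T (covᵇ P x y)

module _ (P : FinPoset n) (i : ℕ) (s : Fin n → Maybe ℕ) where

  slide-at : ∀ {x m} → s x ≡ m → slide P i s x ≡ slideAt i (fills P i s x) (vacates P s x) m
  slide-at {x} sx = trans (slide-unfold P i s x) (cong (slideAt i _ _) sx)

  slide-fills : ∀ {x y} → s x ≡ nothing → x ⋖⟨ P ⟩ y → s y ≡ just i → slide P i s x ≡ just i
  slide-fills {x} {y} sx x⋖y sy = trans (slide-at sx)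
    (if-T {b = fills P i s x} (any-allFin⁺ y (Equivalence.from T-∧ (x⋖y , holdsLabel⁺ sy))))

  slide-keeps-box : ∀ {x} → s x ≡ nothing → (∀ y → x ⋖⟨ P ⟩ y → s y ≢ just i) → slide P i s x ≡ nothing
  slide-keeps-box {x} sx none = trans (slide-at sx)
    (if-¬T {b = fills P i s x} (any-allFin⁻ λ y t → let (x⋖y , ly) = Equivalence.to T-∧ t in none y x⋖y (holdsLabel⁻ ly)))

  slide-vacates : ∀ {x z} → s x ≡ just i → z ⋖⟨ P ⟩ x → s z ≡ nothing → slide P i s x ≡ nothing
  slide-vacates {x} {z} sx z⋖x sz = trans (slide-at sx)
    (if-T {b = (i ≡ᵇ i) ∧ vacates P s x}
      (Equivalence.from T-∧ (≡⇒≡ᵇ i i refl , any-allFin⁺ z (Equivalence.from T-∧ (z⋖x , is-nothing⁺ sz)))))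

  slide-keeps-label : ∀ {x} → s x ≡ just i → (∀ z → z ⋖⟨ P ⟩ x → s z ≢ nothing) → slide P i s x ≡ just i
  slide-keeps-label {x} sx none = trans (slide-at sx)
    (if-¬T {b = (i ≡ᵇ i) ∧ vacates P s x} λ t →
      any-allFin⁻ (λ z u → let (z⋖x , bz) = Equivalence.to T-∧ u in none z z⋖x (is-nothing⁻ bz))
                  (proj₂ (Equivalence.to T-∧ t)))

  slide-keeps-other : ∀ {x v} → s x ≡ just v → v ≢ i → slide P i s x ≡ just v
  slide-keeps-other {x} {v} sx v≢i = trans (slide-at sx)
    (if-¬T {b = (v ≡ᵇ i) ∧ vacates P s x} λ t → v≢i (≡ᵇ⇒≡ v i (proj₁ (Equivalence.to T-∧ t))))

  slide-elsewhere : ∀ {x} → s x ≢ nothing → s x ≢ just i → slide P i s x ≡ s x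
  slide-elsewhere {x} sx≢□ sx≢i = keep (s x) refl
    where
    keep : ∀ m → s x ≡ m → slide P i s x ≡ m
    keep nothing  sx = contradiction sx sx≢□
    keep (just v) sx with v ≟ i
    ... | yes refl = contradiction sx sx≢i
    ... | no v≢i   = slide-keeps-other sx v≢i

  slide-idle : (∀ b y → ¬ (b ⋖⟨ P ⟩ y × s b ≡ nothing × s y ≡ just i)) → slide P i s ≗ s
  slide-idle stuck x = keep (s x) refl
    where
    keep : ∀ m → s x ≡ m → slide P i s x ≡ m
    keep nothing  sx = slide-keeps-box sx (λ y x⋖y sy → stuck x y (x⋖y , sx , sy))
    keep (just v) sx with v ≟ i
    ... | yes refl = slide-keeps-label sx (λ z z⋖x sz → stuck z x (z⋖x , sz , sx))
    ... | no v≢i   = slide-keeps-other sx v≢i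

  slide-swap : Injective _≡_ _≡_ s → ∀ {b y} → b ⋖⟨ P ⟩ y → s b ≡ nothing → s y ≡ just i →
               slide P i s ≗ s ∘ PC.transpose b y
  slide-swap inj {b} {y} b⋖y sb sy x = by-position (x FinP.≟ b) (x FinP.≟ y)
    where
    by-position : Dec (x ≡ b) → Dec (x ≡ y) → slide P i s x ≡ s (PC.transpose b y x)
    by-position (yes refl) _ = trans (slide-fills sb b⋖y sy) (sym (trans (cong s (transpose-matchˡ x y)) sy))
    by-position (no x≢b) (yes refl) = trans (slide-vacates sy b⋖y sb) (sym (trans (cong s (transpose-matchʳ b x)) sb))
    by-position (no x≢b) (no x≢y) =
      trans (slide-elsewhere (x≢b ∘ inj ∘ flip trans (sym sb)) (x≢y ∘ inj ∘ flip trans (sym sy)))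
            (sym (cong s (transpose-other x≢b x≢y)))

  slide-permutes : Injective _≡_ _≡_ s → Σ (Permutation′ n) λ π → slide P i s ≗ s ∘ (π ⟨$⟩ʳ_)
  slide-permutes inj with FinP.any? (λ b → FinP.any? (λ y →
                            T? (covᵇ P b y) ×-dec ≡-dec _≟_ (s b) nothing ×-dec ≡-dec _≟_ (s y) (just i)))
  ... | yes (b , y , b⋖y , sb , sy) = transpose b y , slide-swap inj b⋖y sb sy
  ... | no stuck                    = Perm.id , slide-idle (λ b y h → stuck (b , y , h))

slides-permute : (P : FinPoset n) {s : Fin n → Maybe ℕ} → Injective _≡_ _≡_ s → ∀ is →
                 Σ (Permutation′ n) λ π → foldl (λ s i → slide P i s) s is ≗ s ∘ (π ⟨$⟩ʳ_)
slides-permute P inj []               = Perm.id , λ _ → refl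
slides-permute P {s} inj (i ∷ is) with slide-permutes P i s inj
... | π₁ , slide≗ with slides-permute P (injective-resp-≗ slide≗ (λ eq → permute-injective π₁ (inj eq))) is
...   | π₂ , slides≗ = π₂ ∘ₚ π₁ , λ x → trans (slides≗ x) (slide≗ (π₂ ⟨$⟩ʳ x))

boxOne : ℕ → Maybe ℕ
boxOne v = if v ≡ᵇ 1 then nothing else just v

boxOne-injective : Injective _≡_ _≡_ boxOne
boxOne-injective {u} {v} eq = trans (sym (unbox u)) (trans (cong (fromMaybe 1) eq) (unbox v))
  where
  unbox : ∀ v → fromMaybe 1 (boxOne v) ≡ v
  unbox 0             = refl
  unbox 1             = refl
  unbox (suc (suc _)) = refl

readout-boxOne : ∀ q v → maybe (_∸ 1) q (boxOne v) ≡ rotate q v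
readout-boxOne q 0             = refl
readout-boxOne q 1             = refl
readout-boxOne q (suc (suc _)) = refl

Pro-permutes : (P : FinPoset n) (q : ℕ) {f : Labeling n} → Injective _≡_ _≡_ f →
               Σ (Permutation′ n) λ π → Pro P q f ≗ rotate q ∘ f ∘ (π ⟨$⟩ʳ_)
Pro-permutes P q {f} inj with slides-permute P {boxOne ∘ f} (inj ∘ boxOne-injective) (map (2 +_) (upTo (q ∸ 1)))
... | π , slides≗ = π , λ x → trans (cong (maybe (_∸ 1) q) (slides≗ x)) (readout-boxOne q (f (π ⟨$⟩ʳ x)))

-- Promotion orbits

∑-const : ∀ n c → ∑[ x < n ] c ≡ n * c
∑-const zero    c = refl
∑-const (suc n) c = cong (c +_) (∑-const n c)

∑ℕ-∑-comm : ∀ N (F : ℕ → Fin n → ℕ) → ∑ℕ N (λ k → ∑[ x < n ] F k x) ≡ ∑[ x < n ] ∑ℕ N (λ k → F k x)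
∑ℕ-∑-comm {n} N F = begin
  ∑ℕ N (λ k → ∑[ x < n ] F k x)                 ≡⟨ ∑ℕ≡∑ N _ ⟩
  ∑[ k < N ] ∑[ x < n ] F (toℕ k) x             ≡⟨ ∑-comm {N} {n} (λ k x → F (toℕ k) x) ⟩
  ∑[ x < n ] ∑[ k < N ] F (toℕ k) x             ≡⟨ sum-cong-≗ (λ x → ∑ℕ≡∑ N (λ k → F k x)) ⟨
  ∑[ x < n ] ∑ℕ N (λ k → F k x)                 ∎
  where open ≡-Reasoning

Tot≡∑ : (g : Labeling n) → Tot g ≡ ∑[ x < n ] g x
Tot≡∑ g = sum-map-tabulate g (λ x → x)

Tot-cong : {f g : Labeling n} → f ≗ g → Tot f ≡ Tot g
Tot-cong {n} f≗g = cong sum (map-cong f≗g (allFin n))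

module _ (P : FinPoset n) (q : ℕ) {f : Labeling n}
         (f-inj : Injective _≡_ _≡_ f) (f-labels : ∀ x → IsLabel q (f x)) where

  private
    ρ = rotate q

  rotated-injective : ∀ k (π : Permutation′ n) → Injective _≡_ _≡_ (iter ρ k ∘ f ∘ (π ⟨$⟩ʳ_))
  rotated-injective k π eq = permute-injective π (f-inj (iter-rotate-injective k (f-labels _) (f-labels _) eq))

  iter-Pro-permutes : ∀ k → Σ (Permutation′ n) λ π → iter (Pro P q) k f ≗ iter ρ k ∘ f ∘ (π ⟨$⟩ʳ_)
  iter-Pro-permutes zero = Perm.id , λ _ → refl
  iter-Pro-permutes (suc k) with iter-Pro-permutes k
  ... | π , iter≗ with Pro-permutes P q (injective-resp-≗ iter≗ (rotated-injective k π))
  ...   | π′ , Pro≗ = π′ ∘ₚ π , λ x → trans (Pro≗ x) (cong ρ (iter≗ (π′ ⟨$⟩ʳ x)))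

  ∑-iter-Pro : ∀ k (h : ℕ → ℕ) → ∑[ x < n ] h (iter (Pro P q) k f x) ≡ ∑[ x < n ] h (iter ρ k (f x))
  ∑-iter-Pro k h with iter-Pro-permutes k
  ... | π , iter≗ = trans (sum-cong-≗ (cong h ∘ iter≗)) (sym (∑-permute (λ x → h (iter ρ k (f x))) π))

  orbit-sum-Tot : .{{_ : NonZero q}} → ∀ m → iter (Pro P q) m f ≗ f →
                  2 * sum (map (λ k → Tot (iter (Pro P q) k f)) (upTo m)) ≡ m * (n * suc q)
  orbit-sum-Tot m closes = *-cancelˡ-≡ _ _ q (begin
    q * (2 * orbit)                                     ≡⟨ m*[n*o]≡n*[m*o] q 2 orbit ⟩
    2 * (q * orbit)                                     ≡⟨ cong (λ s → 2 * (q * s)) orbit≡∑ℕ ⟩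
    2 * (q * ∑ℕ m Tot-after)                            ≡⟨ cong (2 *_) (∑ℕ-periodic-* {m} Tot-after-periodic q) ⟨
    2 * ∑ℕ (q * m) Tot-after                            ≡⟨ cong (2 *_) (∑ℕ-∑-comm (q * m) (λ k x → iter ρ k (f x))) ⟩
    2 * ∑[ x < n ] ∑ℕ (q * m) (λ k → iter ρ k (f x))    ≡⟨ *-distribˡ-sum 2 (λ x → ∑ℕ (q * m) (λ k → iter ρ k (f x))) ⟩
    ∑[ x < n ] (2 * ∑ℕ (q * m) (λ k → iter ρ k (f x)))  ≡⟨ sum-cong-≗ (λ x → cong (λ N → 2 * ∑ℕ N (λ k → iter ρ k (f x))) (*-comm q m)) ⟩
    ∑[ x < n ] (2 * ∑ℕ (m * q) (λ k → iter ρ k (f x)))  ≡⟨ sum-cong-≗ (λ x → ∑ℕ-iter-rotate-* (f-labels x) m) ⟩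
    ∑[ x < n ] (m * (q * suc q))                        ≡⟨ ∑-const n _ ⟩
    n * (m * (q * suc q))                               ≡⟨ rearrange n m q ⟩
    q * (m * (n * suc q))                               ∎)
    where
    open ≡-Reasoning
    orbit = sum (map (λ k → Tot (iter (Pro P q) k f)) (upTo m))
    Tot-after : ℕ → ℕ
    Tot-after k = ∑[ x < n ] iter ρ k (f x)
    orbit≡∑ℕ : orbit ≡ ∑ℕ m Tot-after
    orbit≡∑ℕ = trans (sum-map-applyUpTo _ (λ k → k) m)
                     (∑ℕ-cong m (λ k → trans (Tot≡∑ (iter (Pro P q) k f)) (∑-iter-Pro k (λ v → v))))
    Tot-after-periodic : Periodic m Tot-after
    Tot-after-periodic k = begin
      ∑[ x < n ] iter ρ (m + k) (f x)             ≡⟨ sum-cong-≗ (λ x → trans (cong (λ j → iter ρ j (f x)) (+-comm m k)) (iter-+ ρ k m (f x))) ⟩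
      ∑[ x < n ] iter ρ k (iter ρ m (f x))        ≡⟨ ∑-iter-Pro m (iter ρ k) ⟨
      ∑[ x < n ] iter ρ k (iter (Pro P q) m f x)  ≡⟨ sum-cong-≗ (cong (iter ρ k) ∘ closes) ⟩
      ∑[ x < n ] iter ρ k (f x)                   ∎
    rearrange : ∀ n m q → n * (m * (q * suc q)) ≡ q * (m * (n * suc q))
    rearrange = solve-∀

-- Enumerating Inc^q(P)

_≗?_ : (f g : Labeling n) → Dec (f ≗ g)
f ≗? g = FinP.all? (λ x → f x ≟ g x)

-- `mk v g` stands for the pattern lambda with which `allFuns` prepends the value v to g.
count-product : {c : Labeling (suc n)} {mk : ℕ → Labeling n → Labeling (suc n)} →
                (∀ v g → mk v g zero ≡ v) → (∀ v g i → mk v g (suc i) ≡ g i) →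
                (vs : List ℕ) (gs : List (Labeling n)) →
                count (_≗? c) (concatMap (λ v → map (mk v) gs) vs) ≡ count (_≟ c zero) vs * count (_≗? (c ∘ suc)) gs
count-product {c = c} {mk} mk-head mk-tail vs gs = begin
  count (_≗? c) (concatMap (λ v → map (mk v) gs) vs)         ≡⟨ count-concatMap (_≗? c) (λ v → map (mk v) gs) vs ⟩
  sum (map (λ v → count (_≗? c) (map (mk v) gs)) vs)         ≡⟨ cong sum (map-cong per-head vs) ⟩
  sum (map (λ v → 𝟙 (v ≟ c zero) * count (_≗? (c ∘ suc)) gs) vs) ≡⟨ sum-map-*ʳ (λ v → 𝟙 (v ≟ c zero)) _ vs ⟩
  count (_≟ c zero) vs * count (_≗? (c ∘ suc)) gs             ∎
  where
  open ≡-Reasoning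
  K = count (_≗? (c ∘ suc)) gs
  by-head : ∀ v → (d : Dec (v ≡ c zero)) → count ((_≗? c) ∘ mk v) gs ≡ 𝟙 d * K
  by-head v (yes refl) = trans (count-cong _ _ (All.universal (λ g → mk⇔ tail≗ (cons≗ g)) gs)) (sym (+-identityʳ K))
    where
    tail≗ : ∀ {g} → mk v g ≗ c → g ≗ c ∘ suc
    tail≗ {g} mk≗c i = trans (sym (mk-tail v g i)) (mk≗c (suc i))
    cons≗ : ∀ g → g ≗ c ∘ suc → mk v g ≗ c
    cons≗ g g≗c zero    = mk-head v g
    cons≗ g g≗c (suc i) = trans (mk-tail v g i) (g≗c i)
  by-head v (no v≢c₀) = count-none _ (All.universal (λ g mk≗c → v≢c₀ (trans (sym (mk-head v g)) (mk≗c zero))) gs)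
  per-head : ∀ v → count (_≗? c) (map (mk v) gs) ≡ 𝟙 (v ≟ c zero) * K
  per-head v = trans (count-map (_≗? c) (mk v) gs) (by-head v (v ≟ c zero))

count-labels : ∀ {q v} → IsLabel q v → count (_≟ v) (labels q) ≡ 1
count-labels {q} {suc u} (_ , v≤q) = count-unique _≟_ labels-unique (∈-map⁺ suc (∈-upTo⁺ v≤q))
  where
  labels-unique : Unique (labels q)
  labels-unique = Unique.map⁺ suc-injective (Unique.applyUpTo⁺₁ (λ k → k) q (λ i<j _ → <⇒≢ i<j))

count-allFuns : ∀ n q (c : Labeling n) → (∀ x → IsLabel q (c x)) → count (_≗? c) (allFuns n q) ≡ 1
count-allFuns zero    q c _        = refl
count-allFuns (suc n) q c c-labels =
  trans (count-product (λ _ _ → refl) (λ _ _ _ → refl) (labels q) (allFuns n q))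
        (cong₂ _*_ (count-labels (c-labels zero)) (count-allFuns n q (c ∘ suc) (c-labels ∘ suc)))

InInc-resp-≗ : (P : FinPoset n) (q : ℕ) {f g : Labeling n} → f ≗ g → InInc P q g → InInc P q f
InInc-resp-≗ P q f≗g (g-labels , g-inc) =
  (λ x → subst (IsLabel q) (sym (f≗g x)) (g-labels x)) ,
  (λ x y x≺y → subst₂ _<_ (sym (f≗g x)) (sym (f≗g y)) (g-inc x y x≺y))

count-IncList : (P : FinPoset n) (q : ℕ) {c : Labeling n} → InInc P q c → count (_≗? c) (IncList P q) ≡ 1
count-IncList {n} P q {c} c-inc =
  trans (count-filter (_≗? c) (inInc? P q) (λ f≗c → InInc-resp-≗ P q f≗c c-inc) (allFuns n q))
        (count-allFuns n q c (proj₁ c-inc))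

IncList-InInc : (P : FinPoset n) (q : ℕ) → All (InInc P q) (IncList P q)
IncList-InInc {n} P q = all-filter (inInc? P q) (allFuns n q)

-- Duality

InInc⇒≤1+q : (P : FinPoset n) {q : ℕ} {f : Labeling n} → InInc P q f → ∀ x → f x ≤ suc q
InInc⇒≤1+q P (f-labels , _) x = m≤n⇒m≤1+n (proj₂ (f-labels x))

OrderReversing : FinPoset n → Permutation′ n → Set
OrderReversing P π = ∀ {x y} → _≼_ P x y → _≼_ P (π ⟨$⟩ʳ y) (π ⟨$⟩ʳ x)

module _ (q : ℕ) where

  dual : Permutation′ n → Labeling n → Labeling n
  dual π f x = suc q ∸ f (π ⟨$⟩ʳ x)

  dual-InInc : (P : FinPoset n) {π : Permutation′ n} → OrderReversing P π → ∀ {f} → InInc P q f → InInc P q (dual π f)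
  dual-InInc P {π} π-rev {f} f-InInc@(f-labels , f-inc) = dual-labels , dual-inc
    where
    dual-labels : ∀ x → IsLabel q (dual π f x)
    dual-labels x = m<n⇒0<n∸m (s≤s (proj₂ (f-labels (π ⟨$⟩ʳ x)))) , ∸-monoʳ-≤ (suc q) (proj₁ (f-labels (π ⟨$⟩ʳ x)))
    dual-inc : ∀ x y → _≺_ P x y → dual π f x < dual π f y
    dual-inc x y (x≼y , x≢y) =
      ∸-monoʳ-< (f-inc (π ⟨$⟩ʳ y) (π ⟨$⟩ʳ x) (π-rev x≼y , x≢y ∘ sym ∘ permute-injective π)) (InInc⇒≤1+q P f-InInc (π ⟨$⟩ʳ x))

  dual-involutive : (π : Permutation′ n) {f : Labeling n} → (∀ x → f x ≤ suc q) → dual (Perm.flip π) (dual π f) ≗ f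
  dual-involutive π {f} f≤1+q x = trans (m∸[m∸n]≡n (f≤1+q _)) (cong f (Perm.inverseʳ π))

  Tot-dual : (π : Permutation′ n) {f : Labeling n} → (∀ x → f x ≤ suc q) → Tot f + Tot (dual π f) ≡ n * suc q
  Tot-dual {n} π {f} f≤1+q = begin
    Tot f + Tot (dual π f)                                       ≡⟨ cong₂ _+_ (Tot≡∑ f) (Tot≡∑ (dual π f)) ⟩
    ∑[ x < n ] f x + ∑[ x < n ] (suc q ∸ f (π ⟨$⟩ʳ x))          ≡⟨ cong (_+ ∑[ x < n ] dual π f x) (∑-permute f π) ⟩
    ∑[ x < n ] f (π ⟨$⟩ʳ x) + ∑[ x < n ] (suc q ∸ f (π ⟨$⟩ʳ x)) ≡⟨ ∑-distrib-+ (f ∘ (π ⟨$⟩ʳ_)) (dual π f) ⟨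
    ∑[ x < n ] (f (π ⟨$⟩ʳ x) + (suc q ∸ f (π ⟨$⟩ʳ x)))          ≡⟨ sum-cong-≗ {n} (λ x → m+[n∸m]≡n (f≤1+q (π ⟨$⟩ʳ x))) ⟩
    ∑[ x < n ] suc q                                              ≡⟨ ∑-const n (suc q) ⟩
    n * suc q                                                     ∎
    where open ≡-Reasoning

module _ (P : FinPoset n) (self-dual : SelfDual P) (q : ℕ) where

  private
    φ : Permutation′ n
    φ = proj₁ self-dual
    Inc = IncList P q

  φ-reversing : OrderReversing P φ
  φ-reversing {x} {y} = proj₁ (proj₂ self-dual x y)

  φ⁻¹-reversing : OrderReversing P (Perm.flip φ)
  φ⁻¹-reversing {x} {y} x≼y = proj₂ (proj₂ self-dual (φ ⟨$⟩ˡ y) (φ ⟨$⟩ˡ x))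
    (subst₂ (_≼_ P) (sym (Perm.inverseʳ φ)) (sym (Perm.inverseʳ φ)) x≼y)

  dual≗⇔≗dual : ∀ {f g} → InInc P q f → InInc P q g → (dual q φ f ≗ g) ⇔ (f ≗ dual q (Perm.flip φ) g)
  dual≗⇔≗dual f-inc g-inc = mk⇔
    (λ dual≗g x → trans (sym (dual-involutive q φ (InInc⇒≤1+q P f-inc) x)) (cong (suc q ∸_) (dual≗g _)))
    (λ f≗dual x → trans (cong (suc q ∸_) (f≗dual _)) (dual-involutive q (Perm.flip φ) (InInc⇒≤1+q P g-inc) x))

  sum-Tot-dual : sum (map (Tot ∘ dual q φ) Inc) ≡ sum (map Tot Inc)
  sum-Tot-dual =
    sum-map-double-count (λ f g → dual q φ f ≗ g) (λ f g → dual q φ f ≗? g) Inc Inc Tot-cong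
      (All.map image-unique (IncList-InInc P q)) (All.map preimage-unique (IncList-InInc P q))
    where
    image-unique : ∀ {f} → InInc P q f → count (λ g → dual q φ f ≗? g) Inc ≡ 1
    image-unique {f} f-inc = trans
      (count-cong (λ g → dual q φ f ≗? g) (_≗? dual q φ f) (All.universal (λ _ → mk⇔ (sym ∘_) (sym ∘_)) Inc))
      (count-IncList P q (dual-InInc q P {φ} φ-reversing f-inc))
    preimage-unique : ∀ {g} → InInc P q g → count (λ f → dual q φ f ≗? g) Inc ≡ 1
    preimage-unique {g} g-inc = trans
      (count-cong (λ f → dual q φ f ≗? g) (_≗? dual q (Perm.flip φ) g)
                  (All.map (λ f-inc → dual≗⇔≗dual f-inc g-inc) (IncList-InInc P q)))
      (count-IncList P q (dual-InInc q P {Perm.flip φ} φ⁻¹-reversing g-inc))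

  Inc-sum-Tot : 2 * sum (map Tot Inc) ≡ length Inc * (n * suc q)
  Inc-sum-Tot = begin
    2 * G                               ≡⟨ cong (G +_) (+-identityʳ G) ⟩
    G + G                               ≡⟨ cong (G +_) sum-Tot-dual ⟨
    G + sum (map (Tot ∘ dual q φ) Inc)  ≡⟨ sum-map-+-const Tot (Tot ∘ dual q φ) {xs = Inc} complementary ⟩
    length Inc * (n * suc q)            ∎
    where
    open ≡-Reasoning
    G = sum (map Tot Inc)
    complementary : All (λ f → Tot f + Tot (dual q φ f) ≡ n * suc q) Inc
    complementary = All.map (Tot-dual q φ ∘ InInc⇒≤1+q P) (IncList-InInc P q)

cross-multiply : ∀ {d a b c l m} .{{_ : NonZero d}} → d * a ≡ m * c → d * b ≡ l * c → a * l ≡ b * m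
cross-multiply {d} {a} {b} {c} {l} {m} da≡mc db≡lc = *-cancelˡ-≡ (a * l) (b * m) d (begin
  d * (a * l)  ≡⟨ *-assoc d a l ⟨
  d * a * l    ≡⟨ cong (_* l) da≡mc ⟩
  m * c * l    ≡⟨ *-assoc m c l ⟩
  m * (c * l)  ≡⟨ cong (m *_) (*-comm c l) ⟩
  m * (l * c)  ≡⟨ cong (m *_) db≡lc ⟨
  m * (d * b)  ≡⟨ m*[n*o]≡n*[m*o] m d b ⟩
  d * (m * b)  ≡⟨ cong (d *_) (*-comm m b) ⟩
  d * (b * m)  ∎)
  where open ≡-Reasoning

proposition6p2 :
    ∀ {n} (P : FinPoset n) → SelfDual P →
    (q : ℕ) → .{{_ : NonZero q}} →
    (f : Labeling n) → InInc P q f →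
    IsLinearExtension P (deflate f) →
    (r ℓ τ : ℕ) →
    IsPeriod q (Con f q) ℓ →
    Packed r (deflate f) →
    IsOrbitSize P r (deflate f) τ →
    gcd ((r * ℓ) / q) τ ≡ 1 →
    (m : ℕ) → IsOrbitSize P q f m →
    Orbitmesic P q f m
proposition6p2 {n} P self-dual q f (f-labels , _) (_ , deflate-injective , _) _ _ _ _ _ _ _ m (_ , closes , _) =
  cross-multiply {2} {orbit} {Inc-sum} {n * suc q} {length (IncList P q)} {m}
    (orbit-sum-Tot P q f-injective f-labels m closes) (Inc-sum-Tot P self-dual q)
  where
  orbit   = sum (map (λ k → Tot (iter (Pro P q) k f)) (upTo m))
  Inc-sum = sum (map Tot (IncList P q))
  f-injective : Injective _≡_ _≡_ f
  f-injective {x} {y} fx≡fy = deflate-injective x y (cong (λ v → length (filter (_≤? v) (usedLabels f))) fx≡fy)
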